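{- Let $\Phi$ be a set of formulas each of the form $\Diamond^m p\to\Diamond^n p$ with $n>m>1$, and let $\varphi$ be a modal formula. If $\varphi$ is satisfiable in a $\mathbf{K}\oplus\Phi$ frame, then $\varphi$ is satisfied at a root $r$ of a model $(W,R,V)$ (rooted at $r$) such that: (i) for all $x,y\in W$, if $xRy$ then there exists $y'\in W$ with $xRy'$, $\mathrm{d}_r(y')=\mathrm{d}_r(x)+1$, and $y'\sim y$; and (ii) for each $\Diamond^m p\to\Diamond^n p\in\Phi$ and all $x,z\in W$, if $xR^m z$ then there exist $w_1,\dots,w_{n-1}\in W$ with $xRw_1Rw_2\cdots Rw_{n-1}Rz$ and $\mathrm{d}_r(w_j)=\mathrm{d}_r(x)+j$ for each $j\in\{1,\dots,n-1\}$.
   Context: A frame is a pair $(W,R)$ with $R\subseteq W\times W$; a model adds a valuation $V$ from propositional variables to subsets of $W$. $R^0$ is the identity and $R^{k+1}=R^k\circ R$. A frame is rooted at $r$ if every point is reachable from $r$ by some $R^k$. For $(W,R)$ rooted at $r$, the depth $\mathrm{d}_r(w)=\min\{k\mid rR^kw\}$. A $\mathbf{K}\oplus\Phi$ frame is a frame satisfying $\forall x,y\,(xR^my\to xR^ny)$ for each $\Diamond^mp\to\Diamond^np\in\Phi$ (equivalently, validating $\Phi$). $y'\sim y$ means $y'$ and $y$ are bisimilar within the model $(W,R,V)$: there is a relation $Z\subseteq W\times W$ containing $(y',y)$ such that for all $(w,w')\in Z$: $w,w'$ satisfy the same propositional variables; if $wRv$ there is $v'$ with $w'Rv'$ and $vZv'$;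 and if $w'Rv'$ there is $v$ with $wRv$ and $vZv'$. -}

module Defs where

open import Data.Nat using (ℕ; zero; suc; _+_; _<_; _≤_)
open import Data.Product using (Σ; _×_; ∃)
open import Data.Sum using (_⊎_)
open import Data.Empty using (⊥)
open import Data.Unit using (⊤)
open import Relation.Binary.PropositionalEquality using (_≡_)

data Form : Set where
  var  : ℕ → Form
  ⊥'   : Form
  ⊤'   : Form
  ¬'_  : Form → Form
  _∧'_ : Form → Form → Form
  _∨'_ : Form → Form → Form
  _⇒'_ : Form → Form → Form
  ◇_   : Form → Form
  □_   : Form → Form

record Frame : Set₁ where
  field
    W : Set
    R : W → W → Set

record Model : Set₁ where
  field
    frame : Frame
    V     : ℕ → Frame.W frame → Set
  open Frame frame public

Pow : {W : Set} → (W → W → Set) → ℕ → W → W → Set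
Pow R zero    x y = x ≡ y
Pow R (suc k) x y = Σ _ λ z → Pow R k x z × R z y

_,_⊨_ : (M : Model) → Model.W M → Form → Set
M , w ⊨ var p    = Model.V M p w
M , w ⊨ ⊥'       = ⊥
M , w ⊨ ⊤'       = ⊤
M , w ⊨ (¬' φ)   = (M , w ⊨ φ) → ⊥
M , w ⊨ (φ ∧' ψ) = (M , w ⊨ φ) × (M , w ⊨ ψ)
M , w ⊨ (φ ∨' ψ) = (M , w ⊨ φ) ⊎ (M , w ⊨ ψ)
M , w ⊨ (φ ⇒' ψ) = (M , w ⊨ φ) → (M , w ⊨ ψ)
M , w ⊨ (◇ φ)    = Σ (Model.W M) λ v → Model.R M w v × (M , v ⊨ φ)
M , w ⊨ (□ φ)    = (v : Model.W M) → Model.R M w v → M , v ⊨ φ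

-- Φ is a set of axioms ◇^m p → ◇^n p, represented by the set of pairs (m , n).
AxiomSet : Set₁
AxiomSet = ℕ → ℕ → Set

IsKΦFrame : AxiomSet → Frame → Set
IsKΦFrame Φ F = ∀ m n → Φ m n → ∀ x y → Pow R m x y → Pow R n x y
  where open Frame F

SatisfiableInKΦFrame : AxiomSet → Form → Set₁
SatisfiableInKΦFrame Φ φ =
  Σ Frame λ F → IsKΦFrame Φ F ×
  Σ (ℕ → Frame.W F → Set) λ V → Σ (Frame.W F) λ w →
    record { frame = F ; V = V } , w ⊨ φ

RootedAt : (F : Frame) → Frame.W F → Set
RootedAt F r = ∀ w → Σ ℕ λ k → Pow (Frame.R F) k r w

Depth : (F : Frame) → Frame.W F → Frame.W F → ℕ → Set
Depth F r w k = Pow (Frame.R F) k r w × (∀ j → j < k → Pow (Frame.R F) j r w → ⊥)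

IsBisim : (M : Model) → (Model.W M → Model.W M → Set) → Set
IsBisim M Z = ∀ w w' → Z w w' →
    (∀ p → (Model.V M p w → Model.V M p w') × (Model.V M p w' → Model.V M p w))
  × (∀ v → Model.R M w v → Σ (Model.W M) λ v' → Model.R M w' v' × Z v v')
  × (∀ v' → Model.R M w' v' → Σ (Model.W M) λ v → Model.R M w v × Z v v')

Bisimilar : (M : Model) → Model.W M → Model.W M → Set₁
Bisimilar M y' y = Σ (Model.W M → Model.W M → Set) λ Z → IsBisim M Z × Z y' y

CondI : (M : Model) → Model.W M → Set₁
CondI M r = ∀ x y → Model.R M x y →
  Σ (Model.W M) λ y' → Model.R M x y' ×
    (Σ ℕ λ k → Depth (Model.frame M) r x k × Depth (Model.frame M) r y' (suc k)) ×
    Bisimilar M y' y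

CondII : AxiomSet → (M : Model) → Model.W M → Set
CondII Φ M r = ∀ m n → Φ m n → ∀ x z → Pow (Model.R M) m x z →
  Σ (ℕ → Model.W M) λ w →
    (w 0 ≡ x) × (w n ≡ z) ×
    (∀ j → j < n → Model.R M (w j) (w (suc j))) ×
    (Σ ℕ λ k → Depth (Model.frame M) r x k ×
       (∀ j → 1 ≤ j → j < n → Depth (Model.frame M) r (w j) (k + j)))

{-# OPTIONS --safe #-}
-- Replace the frame by its layered unravelling: a node is a point v together with an R-path
-- of some length ℓ (its level) from the root to v, and a node a sees b when the underlying
-- points are R-related and level b ≤ level a + 1. Every edge raises the level by at most one,
-- so levels are depths. Forgetting the path is a bounded morphism onto the original model, so
-- truth is preserved and nodes over the same point are bisimilar; since an R-step can always be
-- taken to a node exactly one level deeper, this gives (i). For (ii), a path x R^m z projects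
-- to an R^m-path, the frame condition turns it into an R^n-path, and all but its last step are
-- lifted one level at a time above x; the last step may end at z because
-- level z ≤ level x + m ≤ level x + n.
module Submission where

open import Defs
open import Data.Nat using (ℕ; _<_; zero; suc; _+_; _≤_; s≤s)
open import Data.Nat.Properties using (m≤m+n; ≤-refl; ≤-trans; ≤-pred; <⇒≤; <-irrefl; +-identityʳ; +-suc; +-comm; +-monoʳ-≤)
open import Data.Product using (Σ; _×_; _,_; proj₁; proj₂)
open import Data.Product.Function.NonDependent.Propositional using (_×-⇔_)
open import Data.Sum.Function.Propositional using (_⊎-⇔_)
open import Function.Base using (_∘_)
open import Function.Bundles using (_⇔_; mk⇔; Equivalence)
open import Function.Construct.Identity using (⇔-id)
open import Function.Related.TypeIsomorphisms using (→-cong-⇔; ¬-cong-⇔)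
open import Relation.Binary.PropositionalEquality using (_≡_; refl; sym; trans; subst)

open Equivalence using (to; from)

Pow-map : ∀ {A B : Set} {R : A → A → Set} {S : B → B → Set} {f : A → B} →
          (∀ {x y} → R x y → S (f x) (f y)) → ∀ n {x y} → Pow R n x y → Pow S n (f x) (f y)
Pow-map g zero    refl           = refl
Pow-map g (suc n) (z , xz , zy) = _ , Pow-map g n xz , g zy

data Path {W : Set} (R : W → W → Set) : ℕ → W → W → Set where
  []  : ∀ {x} → Path R 0 x x
  _∷_ : ∀ {n x y z} → R x y → Path R n y z → Path R (suc n) x z

_∷ʳ_ : ∀ {W} {R : W → W → Set} {n x y z} → Path R n x y → R y z → Path R (suc n) x z
[]       ∷ʳ yz = yz ∷ []
(xw ∷ p) ∷ʳ yz = xw ∷ (p ∷ʳ yz)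

Pow⇒Path : ∀ {W} {R : W → W → Set} n {x y} → Pow R n x y → Path R n x y
Pow⇒Path zero    refl           = []
Pow⇒Path (suc n) (z , xz , zy) = Pow⇒Path n xz ∷ʳ zy

record IsBoundedMorphism (M N : Model) (f : Model.W M → Model.W N) : Set where
  field
    valuation : ∀ p w → Model.V M p w ⇔ Model.V N p (f w)
    forth     : ∀ {w v} → Model.R M w v → Model.R N (f w) (f v)
    back      : ∀ {w u} → Model.R N (f w) u → Σ (Model.W M) λ v → Model.R M w v × f v ≡ u

module _ {M N : Model} {f : Model.W M → Model.W N} (hom : IsBoundedMorphism M N f) where
  open IsBoundedMorphism hom
  open Model M using (R)

  ⊨-invariant : ∀ φ w → (M , w ⊨ φ) ⇔ (N , f w ⊨ φ)
  ⊨-invariant (var p)  w = valuation p w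
  ⊨-invariant ⊥'       w = ⇔-id _
  ⊨-invariant ⊤'       w = ⇔-id _
  ⊨-invariant (¬' φ)   w = ¬-cong-⇔ (⊨-invariant φ w)
  ⊨-invariant (φ ∧' ψ) w = ⊨-invariant φ w ×-⇔ ⊨-invariant ψ w
  ⊨-invariant (φ ∨' ψ) w = ⊨-invariant φ w ⊎-⇔ ⊨-invariant ψ w
  ⊨-invariant (φ ⇒' ψ) w = →-cong-⇔ (⊨-invariant φ w) (⊨-invariant ψ w)
  ⊨-invariant (◇ φ)    w = mk⇔
    (λ (v , wv , v⊨φ) → f v , forth wv , to (⊨-invariant φ v) v⊨φ)
    (λ (u , fwu , u⊨φ) → let (v , wv , fv≡u) = back fwu in
      v , wv , from (⊨-invariant φ v) (subst (λ u → N , u ⊨ φ) (sym fv≡u) u⊨φ))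
  ⊨-invariant (□ φ)    w = mk⇔
    (λ w⊨□φ u fwu → let (v , wv , fv≡u) = back fwu in
      subst (λ u → N , u ⊨ φ) fv≡u (to (⊨-invariant φ v) (w⊨□φ v wv)))
    (λ fw⊨□φ v wv → from (⊨-invariant φ v) (fw⊨□φ (f v) (forth wv)))

  sameImage-successor : ∀ {v w v′} → f v ≡ f w → R v v′ → Σ (Model.W M) λ w′ → R w w′ × f w′ ≡ f v′
  sameImage-successor {v′ = v′} fv≡fw vv′ = back (subst (λ u → Model.R N u (f v′)) fv≡fw (forth vv′))

  kernel-isBisim : IsBisim M (λ v w → f v ≡ f w)
  kernel-isBisim v w fv≡fw =
      (λ p → transport p fv≡fw , transport p (sym fv≡fw))
    , (λ v′ vv′ → let (w′ , ww′ , eq) = sameImage-successor fv≡fw vv′ in w′ , ww′ , sym eq)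
    , (λ w′ ww′ → sameImage-successor (sym fv≡fw) ww′)
    where
    transport : ∀ p {v w} → f v ≡ f w → Model.V M p v → Model.V M p w
    transport p {v} {w} eq = from (valuation p w) ∘ subst (Model.V N p) eq ∘ to (valuation p v)

module Layered (F : Frame) (V : ℕ → Frame.W F → Set) (r : Frame.W F) where
  open Frame F

  record Node : Set where
    constructor node
    field
      level : ℕ
      point : W
      path  : Pow R level r point
  open Node public

  _↝_ : Node → Node → Set
  a ↝ b = R (point a) (point b) × level b ≤ suc (level a)

  frame : Frame
  frame = record { W = Node ; R = _↝_ }

  model : Model
  model = record { frame = frame ; V = λ p a → V p (point a) }

  base : Model
  base = record { frame = F ; V = V }

  root : Node
  root = node 0 r refl

  step : (a : Node) {v : W} → R (point a) v → Node
  step a {v} av = node (suc (level a)) v (point a , path a , av)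

  ↝-step : (a : Node) {v : W} (av : R (point a) v) → a ↝ step a av
  ↝-step a av = av , ≤-refl

  point-isBoundedMorphism : IsBoundedMorphism model base point
  point-isBoundedMorphism = record
    { valuation = λ p a → ⇔-id _
    ; forth     = proj₁
    ; back      = λ {a} av → step a av , ↝-step a av , refl
    }

  root-reaches : (a : Node) → Pow _↝_ (level a) root a
  root-reaches (node ℓ v rv) = lift-path ℓ rv
    where
    lift-path : ∀ ℓ {v} (rv : Pow R ℓ r v) → Pow _↝_ ℓ root (node ℓ v rv)
    lift-path zero    refl           = refl
    lift-path (suc ℓ) (c , rc , cv) = node ℓ c rc , lift-path ℓ rc , cv , ≤-refl

  level-bound : ∀ i {a b} → Pow _↝_ i a b → level b ≤ level a + i
  level-bound zero    {a}     refl                = m≤m+n (level a) 0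
  level-bound (suc i) {a} {b} (_ , ac , (_ , c≤b)) =
    subst (level b ≤_) (sym (+-suc (level a) i)) (≤-trans c≤b (s≤s (level-bound i ac)))

  depth-level : (a : Node) → Depth frame root a (level a)
  depth-level a = root-reaches a , λ j j<ℓ rj → <-irrefl refl (≤-trans j<ℓ (level-bound j rj))

  rooted : RootedAt frame root
  rooted a = level a , root-reaches a

  condI : CondI model root
  condI a b (ab , _) =
    step a ab , ↝-step a ab , (level a , depth-level a , depth-level (step a ab)) ,
    (_ , kernel-isBisim point-isBoundedMorphism , refl)

  climb : ∀ {n c} (a b : Node) → Path R n (point a) c → R c (point b) → ℕ → Node
  climb a b p        cb zero    = a
  climb a b []       cb (suc j) = b
  climb a b (ac ∷ p) cb (suc j) = climb (step a ac) b p cb j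

  climb-end : ∀ {n c} {a b : Node} (p : Path R n (point a) c) (cb : R c (point b)) →
              climb a b p cb (suc n) ≡ b
  climb-end []       cb = refl
  climb-end (ac ∷ p) cb = climb-end p cb

  climb-level : ∀ {n c} {a b : Node} (p : Path R n (point a) c) (cb : R c (point b)) →
                ∀ j → j ≤ n → level (climb a b p cb j) ≡ level a + j
  climb-level {a = a} p        cb zero    _         = sym (+-identityʳ (level a))
  climb-level {a = a} (ac ∷ p) cb (suc j) (s≤s j≤n) =
    trans (climb-level p cb j j≤n) (sym (+-suc (level a) j))

  climb-↝ : ∀ {n c} {a b : Node} (p : Path R n (point a) c) (cb : R c (point b)) →
            level b ≤ level a + suc n → ∀ j → j < suc n → climb a b p cb j ↝ climb a b p cb (suc j)
  climb-↝ {a = a} {b} []       cb b≤a+1 zero    _         = cb , subst (level b ≤_) (+-comm (level a) 1) b≤a+1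
  climb-↝ {a = a}     (ac ∷ p) cb _     zero    _         = ↝-step a ac
  climb-↝             []       cb _     (suc j) (s≤s ())
  climb-↝ {a = a} {b} (ac ∷ p) cb b≤    (suc j) (s≤s j<n) =
    climb-↝ p cb (subst (level b ≤_) (+-suc (level a) _) b≤) j j<n

  condII : (Φ : AxiomSet) → IsKΦFrame Φ F → (∀ m n → Φ m n → m ≤ n) → CondII Φ model root
  condII Φ K bounded zero zero _ a .a refl =
    (λ _ → a) , refl , refl , (λ _ ()) , level a , depth-level a , λ _ _ ()
  condII Φ K bounded (suc m) zero h a b ab with bounded (suc m) zero h
  ... | ()
  condII Φ K bounded m (suc n) h a b ab =
    let (_ , ac , cb) = K m (suc n) h _ _ (Pow-map proj₁ m ab)
        p             = Pow⇒Path n ac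
    in
    climb a b p cb , refl , climb-end p cb ,
    climb-↝ p cb (≤-trans (level-bound m ab) (+-monoʳ-≤ (level a) (bounded m (suc n) h))) ,
    level a , depth-level a ,
    λ j _ j<n → subst (Depth frame root _) (climb-level p cb j (≤-pred j<n)) (depth-level _)

mainTheorem3 : (Φ : AxiomSet) → (∀ m n → Φ m n → (1 < m) × (m < n)) →
    (φ : Form) → SatisfiableInKΦFrame Φ φ →
    Σ Model λ M → Σ (Model.W M) λ r →
      RootedAt (Model.frame M) r × (M , r ⊨ φ) × CondI M r × CondII Φ M r
mainTheorem3 Φ bounds φ (F , K , V , r , r⊨φ) =
  model , root , rooted , from (⊨-invariant point-isBoundedMorphism φ root) r⊨φ , condI ,
  condII Φ K (λ m n h → <⇒≤ (proj₂ (bounds m n h)))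
  where open Layered F V r
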